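{- Let $(L;\leq,\oplus,',0,1)$ be a weak lattice effect algebra. Then for all $a,b,c\in L$: (W4) if $a\oplus 1$ is defined, then $a=0$; (W5) if $a\oplus b$ is defined and $a\oplus b=c$, then (i) $a\leq c$ and $b\leq c$, and (ii) $a\oplus c'$ and $b\oplus c'$ are defined and $a\oplus c'\leq b'$ and $b\oplus c'\leq a'$; (W6) if $a\oplus a'=r$, then $r'\leq a\leq r$; (W7) $a\leq b$ and $a\oplus b'\neq 1$ if and only if there is $c\in L$ with $c\neq 0$ such that $a\oplus c$ is defined and $a\oplus c\leq b$; (W8) $a\oplus c$ is defined and $a\oplus c\leq b$ if and only if $b'\oplus c$ is defined and $b'\oplus c\leq a'$.
   Context: A bounded involutive lattice is a structure $(L;\leq,',0,1)$ where $(L;\leq,0,1)$ is a bounded lattice and $'$ is a unary operation with $a''=a$ for all $a$ and $a\leq b\Rightarrow b'\leq a'$ (so $0'=1$). A weak lattice effect algebra is a bounded involutive lattice $(L;\leq,\oplus,',0,1)$ with a partial binary operation $\oplus$ such that $a\oplus b$ is defined if and only if $a\leq b'$, and: (W1) if $a\oplus b$ is defined then $a\oplus b=b\oplus a$; (W2) if $b\oplus c$ and $a\oplus(b\oplus c)$ are defined then $a\oplus b$ and $(a\oplus b)\oplus c$ are defined and $a\oplus(b\oplus c)=(a\oplus b)\oplus c$; (W3) $a\oplus 0=a$ for every $a\in L$. -}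

module Defs where

open import Level using (Level; _⊔_) renaming (suc to lsuc)
open import Relation.Binary.PropositionalEquality using (_≡_)
open import Data.Product using (_×_)
open import Relation.Binary.Lattice.Structures using (IsBoundedLattice)

-- The partial operation ⊕ is modelled as a total function _⊕_ together with
-- the domain predicate  Defined a b := a ≤ b ′ ; its values outside the
-- domain are irrelevant (no axiom mentions them), and every statement only
-- uses a ⊕ b under the hypothesis that it is defined.
record WeakLatticeEffectAlgebra (c ℓ : Level) : Set (lsuc (c ⊔ ℓ)) where
  infix  4 _≤_
  infixr 7 _∧_
  infixr 6 _∨_
  infixl 6 _⊕_
  infix  8 _′
  field
    Carrier : Set c
    _≤_     : Carrier → Carrier → Set ℓ
    _∨_     : Carrier → Carrier → Carrier
    _∧_     : Carrier → Carrier → Carrier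
    𝟘       : Carrier
    𝟙       : Carrier
    _′      : Carrier → Carrier
    _⊕_     : Carrier → Carrier → Carrier
    isBoundedLattice : IsBoundedLattice _≡_ _≤_ _∨_ _∧_ 𝟙 𝟘
    involutive : ∀ a → (a ′) ′ ≡ a
    antitone   : ∀ {a b} → a ≤ b → b ′ ≤ a ′

  Defined : Carrier → Carrier → Set ℓ
  Defined a b = a ≤ b ′

  field
    W1 : ∀ {a b} → Defined a b → a ⊕ b ≡ b ⊕ a
    W2 : ∀ {a b c} → Defined b c → Defined a (b ⊕ c) →
         Defined a b × Defined (a ⊕ b) c × (a ⊕ (b ⊕ c) ≡ (a ⊕ b) ⊕ c)
    -- (W3)  (a ⊕ 0 is always defined since a ≤ 1 = 0′)
    W3 : ∀ a → a ⊕ 𝟘 ≡ a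

module Submission where

-- All five properties follow from the axioms by one use of associativity (W2).
--
-- Key lemma (room-for-complement, which is the forward half of W8): if a ⊕ c is
-- defined and a ⊕ c ≤ b, then b′ ≤ (a ⊕ c)′ = (c ⊕ a)′, so b′ ⊕ (c ⊕ a) is
-- defined and W2 re-brackets it as (b′ ⊕ c) ⊕ a.  Definedness of the two
-- inner sums says exactly  b′ ⊕ c  is defined and  b′ ⊕ c ≤ a′.
--
-- W8 is the key lemma together with its instance at (b′, a′);
-- W5 is the key lemma applied to a ⊕ b ≤ c and to b ⊕ a ≤ c; W6 is W5 with
-- b = a′; W7 uses the witness (a ⊕ b′)′ in one direction and, in the other,
-- W8 followed by W2 and W4.

open import Defs
open import Data.Product using (_×_; ∃-syntax; _,_)
open import Relation.Binary.PropositionalEquality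
  using (_≡_; refl; sym; trans; subst; cong; subst₂)
open import Relation.Nullary using (¬_)
open import Function.Bundles using (_⇔_; mk⇔)
open import Relation.Binary.Lattice.Structures using (IsBoundedLattice)

module WeakLatticeEffectAlgebraProperties {ℓc ℓ} (E : WeakLatticeEffectAlgebra ℓc ℓ) where
  open WeakLatticeEffectAlgebra E
  open IsBoundedLattice isBoundedLattice using (antisym; maximum; minimum)
    renaming (refl to ≤-refl; trans to ≤-trans)

  Defined-sym : ∀ {a b} → Defined a b → Defined b a
  Defined-sym {a} {b} a≤b′ = subst (_≤ a ′) (involutive b) (antitone a≤b′)

  ≤⇒Defined′ : ∀ {a b} → a ≤ b → Defined a (b ′)
  ≤⇒Defined′ {a} {b} = subst (a ≤_) (sym (involutive b))

  Defined′⇒≤ : ∀ {a b} → Defined a (b ′) → a ≤ b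
  Defined′⇒≤ {a} {b} = subst (a ≤_) (involutive b)

  ′-reflects-≤ : ∀ {a b} → a ′ ≤ b ′ → b ≤ a
  ′-reflects-≤ b′≤a′′ = Defined′⇒≤ (Defined-sym b′≤a′′)

  𝟙′≡𝟘 : 𝟙 ′ ≡ 𝟘
  𝟙′≡𝟘 = antisym (subst (𝟙 ′ ≤_) (involutive 𝟘) (antitone (maximum (𝟘 ′)))) (minimum (𝟙 ′))

  𝟘′≡𝟙 : 𝟘 ′ ≡ 𝟙
  𝟘′≡𝟙 = antisym (maximum (𝟘 ′)) (Defined-sym (minimum (𝟙 ′)))

  Defined-𝟙⇒𝟘 : ∀ a → Defined a 𝟙 → a ≡ 𝟘
  Defined-𝟙⇒𝟘 a a≤𝟙′ = antisym (subst (a ≤_) 𝟙′≡𝟘 a≤𝟙′) (minimum a)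

  room-for-complement : ∀ {a b c} → Defined a c → a ⊕ c ≤ b →
                        Defined (b ′) c × b ′ ⊕ c ≤ a ′
  room-for-complement {a} {b} {c} a⊥c a⊕c≤b with W2 (Defined-sym a⊥c) b′⊥c⊕a
    where
    b′⊥c⊕a : Defined (b ′) (c ⊕ a)
    b′⊥c⊕a = subst (λ s → b ′ ≤ s ′) (W1 a⊥c) (antitone a⊕c≤b)
  ... | b′⊥c , b′⊕c⊥a , _ = b′⊥c , b′⊕c⊥a

  -- (W8, backward) is the forward direction for (b′, a′), up to involution.
  room-for-complement⁻ : ∀ {a b c} → Defined (b ′) c × b ′ ⊕ c ≤ a ′ →
                         Defined a c × a ⊕ c ≤ b
  room-for-complement⁻ {a} {b} {c} (b′⊥c , b′⊕c≤a′) =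
    subst₂ (λ x y → Defined x c × x ⊕ c ≤ y) (involutive a) (involutive b)
      (room-for-complement b′⊥c b′⊕c≤a′)

  right-summand-bounds : ∀ {a b c} → Defined a b → a ⊕ b ≤ c →
                         b ≤ c × Defined b (c ′) × b ⊕ c ′ ≤ a ′
  right-summand-bounds {a} {b} {c} a⊥b a⊕b≤c with room-for-complement a⊥b a⊕b≤c
  ... | c′⊥b , c′⊕b≤a′ =
    ′-reflects-≤ c′⊥b , Defined-sym c′⊥b , subst (_≤ a ′) (W1 c′⊥b) c′⊕b≤a′

  summand-bounds : ∀ a b c → Defined a b → a ⊕ b ≡ c →
                   (a ≤ c × b ≤ c)
                   × (Defined a (c ′) × Defined b (c ′) × a ⊕ c ′ ≤ b ′ × b ⊕ c ′ ≤ a ′)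
  summand-bounds a b c a⊥b refl
    with right-summand-bounds a⊥b ≤-refl
       | right-summand-bounds (Defined-sym a⊥b) (subst (_≤ a ⊕ b) (W1 a⊥b) ≤-refl)
  ... | b≤c , b⊥c′ , b⊕c′≤a′ | a≤c , a⊥c′ , a⊕c′≤b′ =
    (a≤c , b≤c) , (a⊥c′ , b⊥c′ , a⊕c′≤b′ , b⊕c′≤a′)

  orthosum-bounds : ∀ a r → a ⊕ a ′ ≡ r → r ′ ≤ a × a ≤ r
  orthosum-bounds a r a⊕a′≡r with summand-bounds a (a ′) r (≤⇒Defined′ ≤-refl) a⊕a′≡r
  ... | (a≤r , a′≤r) , _ = subst (r ′ ≤_) (involutive a) (antitone a′≤r) , a≤r

  -- (W7, ⇒) The witness is d = (a ⊕ b′)′: it is nonzero since a ⊕ b′ ≠ 𝟙.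
  strict-gap⇒nonzero-summand : ∀ a b → a ≤ b × ¬ (a ⊕ b ′ ≡ 𝟙) →
                               ∃[ d ] (¬ (d ≡ 𝟘) × Defined a d × a ⊕ d ≤ b)
  strict-gap⇒nonzero-summand a b (a≤b , a⊕b′≢𝟙)
    with summand-bounds a (b ′) (a ⊕ b ′) (≤⇒Defined′ a≤b) refl
  ... | (a≤s , _) , (_ , _ , a⊕s′≤b′′ , _) =
    (a ⊕ b ′) ′ , d≢𝟘 , ≤⇒Defined′ a≤s , subst (a ⊕ (a ⊕ b ′) ′ ≤_) (involutive b) a⊕s′≤b′′
    where
    d≢𝟘 : ¬ ((a ⊕ b ′) ′ ≡ 𝟘)
    d≢𝟘 d≡𝟘 = a⊕b′≢𝟙 (trans (sym (involutive (a ⊕ b ′))) (trans (cong _′ d≡𝟘) 𝟘′≡𝟙))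

  -- (W7, ⇐) If a ⊕ b′ were 𝟙, then (a ⊕ b′) ⊕ d would be defined by W8 and W2,
  -- so d = 𝟘 by W4.
  nonzero-summand⇒strict-gap : ∀ a b → ∃[ d ] (¬ (d ≡ 𝟘) × Defined a d × a ⊕ d ≤ b) →
                               a ≤ b × ¬ (a ⊕ b ′ ≡ 𝟙)
  nonzero-summand⇒strict-gap a b (d , d≢𝟘 , a⊥d , a⊕d≤b) = a≤b , a⊕b′≢𝟙
    where
    a≤b : a ≤ b
    a≤b with summand-bounds a d (a ⊕ d) a⊥d refl
    ... | (a≤a⊕d , _) , _ = ≤-trans a≤a⊕d a⊕d≤b

    a⊕b′≢𝟙 : ¬ (a ⊕ b ′ ≡ 𝟙)
    a⊕b′≢𝟙 a⊕b′≡𝟙 with room-for-complement a⊥d a⊕d≤b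
    ... | b′⊥d , b′⊕d≤a′ with W2 b′⊥d (Defined-sym b′⊕d≤a′)
    ...   | _ , a⊕b′⊥d , _ =
      d≢𝟘 (Defined-𝟙⇒𝟘 d (Defined-sym (subst (λ s → Defined s d) a⊕b′≡𝟙 a⊕b′⊥d)))

open WeakLatticeEffectAlgebraProperties

mainTheorem1 : ∀ {ℓc ℓ} (E : WeakLatticeEffectAlgebra ℓc ℓ) →
    let open WeakLatticeEffectAlgebra E in
    ∀ (a b c : Carrier) →
      (Defined a 𝟙 → a ≡ 𝟘)
      × (Defined a b → a ⊕ b ≡ c →
           (a ≤ c × b ≤ c)
           × (Defined a (c ′) × Defined b (c ′) × a ⊕ c ′ ≤ b ′ × b ⊕ c ′ ≤ a ′))
      × (∀ r → a ⊕ a ′ ≡ r → (r ′ ≤ a × a ≤ r))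
      × ((a ≤ b × ¬ (a ⊕ b ′ ≡ 𝟙))
           ⇔ (∃[ d ] (¬ (d ≡ 𝟘) × Defined a d × a ⊕ d ≤ b)))
      × ((Defined a c × a ⊕ c ≤ b) ⇔ (Defined (b ′) c × b ′ ⊕ c ≤ a ′))
mainTheorem1 E a b c =
    Defined-𝟙⇒𝟘 E a
  , summand-bounds E a b c
  , orthosum-bounds E a
  , mk⇔ (strict-gap⇒nonzero-summand E a b) (nonzero-summand⇒strict-gap E a b)
  , mk⇔ (λ (a⊥c , a⊕c≤b) → room-for-complement E a⊥c a⊕c≤b) (room-for-complement⁻ E)
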